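{- For $n\ge1$ let $s(n)$ be the sum of $\mathrm{sper}(w)$ over all Catalan words $w$ of length $n$ avoiding the pattern $(\geq,\geq)$. Then for all $n\ge1$, \[ s(n)=\frac{1}{2}\left(-5 T_n -4 T_{n+1}+3T_{n+2}\right), \] where $T_n=\sum_{k=0}^{n}\binom{n}{k}\binom{n-k}{k}$ is the central trinomial coefficient.
   Context: A Catalan word of length $n\ge 0$ is a sequence $w=w_1\cdots w_n$ of non-negative integers with $w_1=0$ and $0\le w_i\le w_{i-1}+1$ for $i=2,\dots,n$. It avoids the pattern $(\geq,\geq)$ if there is no index $i$ with $w_i\ge w_{i+1}\ge w_{i+2}$. To $w$ is associated the polyomino $P(w)$ with $n$ bottom-aligned columns, the $i$-th column consisting of $w_i+1$ unit cells. $\mathrm{sper}(w)$ is half the perimeter of $P(w)$, the perimeter being the number of cell edges of $P(w)$ not shared with another cell of $P(w)$. $T_n$ is the coefficient of $x^n$ in $(1+x+x^2)^n$. -}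

module Defs where

open import Data.Nat using (ℕ; zero; suc; _+_; _*_; _∸_; _≤ᵇ_; _≡ᵇ_; _⊓_; _/_)
open import Data.Nat.Combinatorics using (_C_)
open import Data.Bool using (Bool; true; false; _∧_; not)
open import Data.List using (List; []; _∷_; map; concatMap; upTo; filter; length)
open import Data.Nat.ListAction using (sum)
open import Relation.Nullary.Decidable using (does)
open import Data.Bool.Properties using (T?)

allLists : ℕ → ℕ → List (List ℕ)
allLists m zero    = [] ∷ []
allLists m (suc k) = concatMap (λ i → map (i ∷_) (allLists m k)) (upTo m)

stepsOK : List ℕ → Bool
stepsOK []           = true
stepsOK (x ∷ [])     = true
stepsOK (x ∷ y ∷ ys) = (y ≤ᵇ suc x) ∧ stepsOK (y ∷ ys)

isCatalan : List ℕ → Bool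
isCatalan []       = true
isCatalan (x ∷ xs) = (x ≡ᵇ 0) ∧ stepsOK (x ∷ xs)

avoidsGeGe : List ℕ → Bool
avoidsGeGe (x ∷ y ∷ z ∷ zs) = not ((y ≤ᵇ x) ∧ (z ≤ᵇ y)) ∧ avoidsGeGe (y ∷ z ∷ zs)
avoidsGeGe _                = true

-- Catalan words of length n avoiding (≥,≥).  Every Catalan word of
-- length n has entries w_i ≤ i - 1 < n, so filtering allLists n n
-- enumerates all of them (each exactly once).
avoidingWords : ℕ → List (List ℕ)
avoidingWords n = filter (λ w → T? (isCatalan w ∧ avoidsGeGe w)) (allLists n n)

-- Polyomino P(w): column i has w_i + 1 cells, bottom-aligned.
-- number of cells
area : List ℕ → ℕ
area w = sum (map suc w)

-- number of pairs of edge-adjacent cells (shared edges):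
-- vertical adjacencies inside column i: w_i;
-- horizontal adjacencies between columns i, i+1: min(w_i+1, w_{i+1}+1).
horizAdj : List ℕ → ℕ
horizAdj (x ∷ y ∷ ys) = (suc x ⊓ suc y) + horizAdj (y ∷ ys)
horizAdj _            = 0

sharedEdges : List ℕ → ℕ
sharedEdges w = sum w + horizAdj w

-- perimeter: cell edges not shared with another cell = 4·cells − 2·shared
perimeter : List ℕ → ℕ
perimeter w = 4 * area w ∸ 2 * sharedEdges w

sper : List ℕ → ℕ
sper w = perimeter w / 2

s : ℕ → ℕ
s n = sum (map sper (avoidingWords n))

T : ℕ → ℕ
T n = sum (map (λ k → (n C k) * ((n ∸ k) C k)) (upTo (suc n)))

module Submission where

-- In a Catalan word avoiding (≥,≥) every weak descent but a final one is followed by an ascent (by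
-- one), and the semi-perimeter of the bargraph is 2 plus the sum of the step weights: 1 for a weak
-- descent, 2 for an ascent.  Recording a weight w as (1 + ε)ʷ in the dual numbers ℕ[ε]/(ε²) makes s(n) the ε-part of
-- a transfer-matrix count of walks on (height, mode).  Cutting the walks at their last descent to
-- height 0 gives a convolution recurrence that determines this count, and closed forms in Motzkin
-- numbers and trinomial coefficients satisfy it, by the last-passage convolution identities of
-- lattice paths and the reflection principle.  As Tₙ is the central trinomial coefficient, the claim
-- becomes a linear relation between four trinomial coefficients.

open import Defs

open import Algebra.Consequences.Propositional using (comm∧assoc⇒middleFour)
open import Algebra.Core using (Op₂)
open import Algebra.Structures using (IsCommutativeSemiring)
open import Data.Bool using (Bool; true; false; not; _∧_; if_then_else_) renaming (T to IsTrue)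
open import Data.Bool.Properties using (∧-assoc; ∧-zeroʳ)
open import Data.Empty using (⊥-elim)
open import Data.List using (List; []; _∷_; _++_; map; foldr; concatMap; applyUpTo; upTo; filter)
open import Data.List.Properties using (map-++; map-∘; map-cong)
open import Data.Nat using (ℕ; zero; suc; _≤_; _<_; _≥_; z≤n; s≤s)
import Data.Nat as Nat
open import Data.Nat.Induction using (<-rec)
open import Data.Nat.Properties
  using (≤-refl; m≤n⇒m≤1+n; m≤n⇒∃[o]m+o≡n; m≤m+n; +-monoʳ-<; +-*-isCommutativeSemiring)
open import Data.Product using (_,_)
open import Data.Unit using (tt)
open import Function using (_∘_)
open import Relation.Binary.PropositionalEquality
open import Relation.Nullary using (does; ofʸ; ofⁿ; contradiction)
open import Relation.Nullary.Decidable using (T?)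
open import Relation.Unary using (Decidable)

module Series {A : Set} {plus times : Op₂ A} {0# 1# : A}
              (isCommutativeSemiring : IsCommutativeSemiring _≡_ plus times 0# 1#) where

  -- Module parameters cannot carry fixity declarations, hence the renaming.
  infixl 6 _+_
  infixl 7 _*_

  _+_ _*_ : Op₂ A
  _+_ = plus
  _*_ = times

  open IsCommutativeSemiring isCommutativeSemiring
    using (+-comm; +-assoc; +-identityˡ; +-identityʳ; *-comm; *-assoc; zeroˡ; zeroʳ; distribˡ)
  open ≡-Reasoning

  *-leftComm : ∀ a b c → a * (b * c) ≡ b * (a * c)
  *-leftComm a b c = trans (sym (*-assoc a b c)) (trans (cong (_* c) (*-comm a b)) (*-assoc b a c))

  +-middleFour : ∀ a b c d → (a + b) + (c + d) ≡ (a + c) + (b + d)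
  +-middleFour = comm∧assoc⇒middleFour +-comm +-assoc

  ∑ : ℕ → (ℕ → A) → A
  ∑ zero    f = 0#
  ∑ (suc n) f = f 0 + ∑ n (f ∘ suc)

  ∑-cong : ∀ n {f g} → (∀ i → i < n → f i ≡ g i) → ∑ n f ≡ ∑ n g
  ∑-cong zero    f≡g = refl
  ∑-cong (suc n) f≡g = cong₂ _+_ (f≡g 0 (s≤s z≤n)) (∑-cong n (λ i i<n → f≡g (suc i) (s≤s i<n)))

  ∑-vanishing : ∀ n {f} → (∀ i → i < n → f i ≡ 0#) → ∑ n f ≡ 0#
  ∑-vanishing zero    f≡0 = refl
  ∑-vanishing (suc n) f≡0 = begin
    _ + ∑ n _ ≡⟨ cong₂ _+_ (f≡0 0 (s≤s z≤n)) (∑-vanishing n (λ i i<n → f≡0 (suc i) (s≤s i<n))) ⟩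
    0# + 0#   ≡⟨ +-identityˡ 0# ⟩
    0#        ∎

  ∑-+ : ∀ m n f → ∑ (m Nat.+ n) f ≡ ∑ m f + ∑ n (λ i → f (m Nat.+ i))
  ∑-+ zero    n f = sym (+-identityˡ _)
  ∑-+ (suc m) n f = trans (cong (f 0 +_) (∑-+ m n (f ∘ suc))) (sym (+-assoc _ _ _))

  ∑-truncate : ∀ {m n} f → m ≤ n → (∀ i → m ≤ i → i < n → f i ≡ 0#) → ∑ n f ≡ ∑ m f
  ∑-truncate {m} f m≤n tail≡0 with m≤n⇒∃[o]m+o≡n m≤n
  ... | r , refl = begin
    ∑ (m Nat.+ r) f                   ≡⟨ ∑-+ m r f ⟩
    ∑ m f + ∑ r (λ i → f (m Nat.+ i)) ≡⟨ cong (∑ m f +_) (∑-vanishing r (λ i i<r →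
                                                tail≡0 _ (m≤m+n m i) (+-monoʳ-< m i<r))) ⟩
    ∑ m f + 0#                             ≡⟨ +-identityʳ _ ⟩
    ∑ m f                                  ∎

  ∑-last : ∀ n f → ∑ (suc n) f ≡ ∑ n f + f n
  ∑-last zero    f = +-comm _ _
  ∑-last (suc n) f = trans (cong (f 0 +_) (∑-last n (f ∘ suc))) (sym (+-assoc _ _ _))

  ∑-distrib-+ : ∀ n f g → ∑ n (λ i → f i + g i) ≡ ∑ n f + ∑ n g
  ∑-distrib-+ zero    f g = sym (+-identityˡ 0#)
  ∑-distrib-+ (suc n) f g =
    trans (cong (f 0 + g 0 +_) (∑-distrib-+ n (f ∘ suc) (g ∘ suc))) (+-middleFour _ _ _ _)

  *-distribˡ-∑ : ∀ c n f → c * ∑ n f ≡ ∑ n (λ i → c * f i)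
  *-distribˡ-∑ c zero    f = zeroʳ c
  *-distribˡ-∑ c (suc n) f = trans (distribˡ c _ _) (cong (c * f 0 +_) (*-distribˡ-∑ c n (f ∘ suc)))

  listSum : List A → A
  listSum = foldr _+_ 0#

  listSum-++ : ∀ xs ys → listSum (xs ++ ys) ≡ listSum xs + listSum ys
  listSum-++ []       ys = sym (+-identityˡ _)
  listSum-++ (x ∷ xs) ys = trans (cong (x +_) (listSum-++ xs ys)) (sym (+-assoc _ _ _))

  listSum-applyUpTo : ∀ {B : Set} (f : B → A) g n → listSum (map f (applyUpTo g n)) ≡ ∑ n (f ∘ g)
  listSum-applyUpTo f g zero    = refl
  listSum-applyUpTo f g (suc n) = cong (f (g 0) +_) (listSum-applyUpTo f (g ∘ suc) n)

  *-distribˡ-listSum : ∀ {B : Set} c (g : B → A) xs → c * listSum (map g xs) ≡ listSum (map (λ x → c * g x) xs)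
  *-distribˡ-listSum c g []       = zeroʳ c
  *-distribˡ-listSum c g (x ∷ xs) = trans (distribˡ c _ _) (cong (c * g x +_) (*-distribˡ-listSum c g xs))

  listSum-vanishing : ∀ {B : Set} {g : B → A} xs → (∀ x → g x ≡ 0#) → listSum (map g xs) ≡ 0#
  listSum-vanishing []       g≡0 = refl
  listSum-vanishing (x ∷ xs) g≡0 = trans (cong₂ _+_ (g≡0 x) (listSum-vanishing xs g≡0)) (+-identityˡ 0#)

  listSum-concatMap : ∀ {B C : Set} (g : C → A) (h : B → List C) xs →
                      listSum (map g (concatMap h xs)) ≡ listSum (map (λ x → listSum (map g (h x))) xs)
  listSum-concatMap g h []       = refl
  listSum-concatMap g h (x ∷ xs) = begin
    listSum (map g (h x ++ concatMap h xs))           ≡⟨ cong listSum (map-++ g (h x) _) ⟩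
    listSum (map g (h x) ++ map g (concatMap h xs))   ≡⟨ listSum-++ (map g (h x)) _ ⟩
    listSum (map g (h x)) + listSum (map g (concatMap h xs)) ≡⟨ cong (listSum (map g (h x)) +_) (listSum-concatMap g h xs) ⟩
    listSum (map g (h x)) + listSum (map (λ x → listSum (map g (h x))) xs) ∎

  listSum-allLists : ∀ n k (g : List ℕ → A) →
                     listSum (map g (allLists n (suc k))) ≡ ∑ n (λ i → listSum (map (g ∘ (i ∷_)) (allLists n k)))
  listSum-allLists n k g = begin
    listSum (map g (concatMap (λ i → map (i ∷_) (allLists n k)) (upTo n)))
      ≡⟨ listSum-concatMap g _ (upTo n) ⟩
    listSum (map (λ i → listSum (map g (map (i ∷_) (allLists n k)))) (upTo n))
      ≡⟨ cong listSum (map-cong (λ i → cong listSum (sym (map-∘ (allLists n k)))) (upTo n)) ⟩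
    listSum (map (λ i → listSum (map (g ∘ (i ∷_)) (allLists n k))) (upTo n))
      ≡⟨ listSum-applyUpTo _ (λ i → i) n ⟩
    ∑ n (λ i → listSum (map (g ∘ (i ∷_)) (allLists n k)))
      ∎

  listSum-filter : ∀ {B : Set} {P : B → Set} (P? : Decidable P) (g : B → A) xs →
                   listSum (map g (filter P? xs)) ≡ listSum (map (λ x → if does (P? x) then g x else 0#) xs)
  listSum-filter P? g []       = refl
  listSum-filter P? g (x ∷ xs) with does (P? x)
  ... | true  = cong (g x +_) (listSum-filter P? g xs)
  ... | false = trans (listSum-filter P? g xs) (sym (+-identityˡ _))

  -- conv f g n = ∑ of f i * g j over i + j = n: the coefficient of xⁿ in the product of the series f and g.
  conv : (ℕ → A) → (ℕ → A) → ℕ → A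
  conv f g zero    = f 0 * g 0
  conv f g (suc n) = conv f (g ∘ suc) n + f (suc n) * g 0

  conv-cong : ∀ n {f f′ g g′} → (∀ i → i ≤ n → f i ≡ f′ i) → (∀ i → i ≤ n → g i ≡ g′ i) →
              conv f g n ≡ conv f′ g′ n
  conv-cong zero    f≡ g≡ = cong₂ _*_ (f≡ 0 z≤n) (g≡ 0 z≤n)
  conv-cong (suc n) f≡ g≡ =
    cong₂ _+_ (conv-cong n (λ i i≤n → f≡ i (m≤n⇒m≤1+n i≤n)) (λ i i≤n → g≡ (suc i) (s≤s i≤n)))
              (cong₂ _*_ (f≡ (suc n) ≤-refl) (g≡ 0 z≤n))

  conv-suc : ∀ n f g → conv f g (suc n) ≡ f 0 * g (suc n) + conv (f ∘ suc) g n
  conv-suc zero    f g = refl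
  conv-suc (suc n) f g = trans (cong (_+ f (suc (suc n)) * g 0) (conv-suc n f (g ∘ suc))) (+-assoc _ _ _)

  conv-comm : ∀ n f g → conv f g n ≡ conv g f n
  conv-comm zero    f g = *-comm (f 0) (g 0)
  conv-comm (suc n) f g = begin
    conv f (g ∘ suc) n + f (suc n) * g 0 ≡⟨ cong₂ _+_ (conv-comm n f (g ∘ suc)) (*-comm (f (suc n)) (g 0)) ⟩
    conv (g ∘ suc) f n + g 0 * f (suc n) ≡⟨ +-comm _ _ ⟩
    g 0 * f (suc n) + conv (g ∘ suc) f n ≡⟨ sym (conv-suc n g f) ⟩
    conv g f (suc n)                     ∎

  conv-distribʳ : ∀ n f g h → conv f (λ i → g i + h i) n ≡ conv f g n + conv f h n
  conv-distribʳ zero    f g h = distribˡ (f 0) (g 0) (h 0)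
  conv-distribʳ (suc n) f g h =
    trans (cong₂ _+_ (conv-distribʳ n f (g ∘ suc) (h ∘ suc)) (distribˡ (f (suc n)) (g 0) (h 0)))
          (+-middleFour _ _ _ _)

  conv-distribˡ : ∀ n f g h → conv (λ i → f i + g i) h n ≡ conv f h n + conv g h n
  conv-distribˡ n f g h = begin
    conv (λ i → f i + g i) h n ≡⟨ conv-comm n _ h ⟩
    conv h (λ i → f i + g i) n ≡⟨ conv-distribʳ n h f g ⟩
    conv h f n + conv h g n    ≡⟨ cong₂ _+_ (conv-comm n h f) (conv-comm n h g) ⟩
    conv f h n + conv g h n    ∎

  conv-scaleʳ : ∀ n c f g → conv f (λ i → c * g i) n ≡ c * conv f g n
  conv-scaleʳ zero    c f g = *-leftComm (f 0) c (g 0)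
  conv-scaleʳ (suc n) c f g =
    trans (cong₂ _+_ (conv-scaleʳ n c f (g ∘ suc)) (*-leftComm (f (suc n)) c (g 0))) (sym (distribˡ c _ _))

  conv-scaleˡ : ∀ n c f g → conv (λ i → c * f i) g n ≡ c * conv f g n
  conv-scaleˡ n c f g = begin
    conv (λ i → c * f i) g n ≡⟨ conv-comm n _ g ⟩
    conv g (λ i → c * f i) n ≡⟨ conv-scaleʳ n c g f ⟩
    c * conv g f n           ≡⟨ cong (c *_) (conv-comm n g f) ⟩
    c * conv f g n           ∎

  conv-zeroˡ : ∀ n g → conv (λ _ → 0#) g n ≡ 0#
  conv-zeroˡ zero    g = zeroˡ (g 0)
  conv-zeroˡ (suc n) g = trans (cong₂ _+_ (conv-zeroˡ n (g ∘ suc)) (zeroˡ (g 0))) (+-identityˡ 0#)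

  conv-∑ˡ : ∀ m n (f : ℕ → ℕ → A) g → conv (λ j → ∑ m (λ i → f i j)) g n ≡ ∑ m (λ i → conv (f i) g n)
  conv-∑ˡ zero    n f g = conv-zeroˡ n g
  conv-∑ˡ (suc m) n f g =
    trans (conv-distribˡ n (f 0) _ g) (cong (conv (f 0) g n +_) (conv-∑ˡ m n (f ∘ suc) g))

module ℕ-Series = Series +-*-isCommutativeSemiring

module Trinomial where

  open import Data.Nat using (_+_; _*_; _∸_)
  open import Data.Nat.Combinatorics using (_C_; nCk+nC[k+1]≡[n+1]C[k+1]; k>n⇒nCk≡0)
  open import Data.Nat.Properties
    using (+-comm; +-assoc; +-identityʳ; *-identityʳ; *-distribˡ-+; *-distribʳ-+; *-zeroʳ; +-∸-assoc;
           m<n⇒m<1+n; n<1+n; n≤1+n; <-cmp; +-suc)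
  open import Data.Nat.Tactic.RingSolver using (solve-∀)
  open import Relation.Binary.Definitions using (tri<; tri≈; tri>)
  open ℕ-Series hiding (_+_; _*_)
  open ≡-Reasoning

  -- trinomial n h counts n-step paths with steps -1, 0, 1 from 0 to h (equivalently to -h);
  -- motzkin n h counts those that never go below 0.
  trinomial motzkin : ℕ → ℕ → ℕ
  trinomial zero    zero    = 1
  trinomial zero    (suc h) = 0
  trinomial (suc n) zero    = trinomial n 1 + trinomial n 0 + trinomial n 1
  trinomial (suc n) (suc h) = trinomial n h + trinomial n (suc h) + trinomial n (2 + h)
  motzkin zero    zero    = 1
  motzkin zero    (suc h) = 0
  motzkin (suc n) zero    = motzkin n 0 + motzkin n 1
  motzkin (suc n) (suc h) = motzkin n h + motzkin n (suc h) + motzkin n (2 + h)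

  trinomial-reflection : ∀ n h → trinomial n h ≡ motzkin n h + trinomial n (2 + h)
  trinomial-reflection zero    zero    = refl
  trinomial-reflection zero    (suc h) = refl
  trinomial-reflection (suc n) zero    = begin
    t 1 + t 0 + t 1                       ≡⟨ cong₂ (λ a b → t 1 + a + b) (trinomial-reflection n 0) (trinomial-reflection n 1) ⟩
    t 1 + (m 0 + t 2) + (m 1 + t 3)       ≡⟨ regroup (t 1) (m 0) (t 2) (m 1) (t 3) ⟩
    m 0 + m 1 + (t 1 + t 2 + t 3)         ∎
    where
    t = trinomial n
    m = motzkin n
    regroup : ∀ t₁ m₀ t₂ m₁ t₃ → t₁ + (m₀ + t₂) + (m₁ + t₃) ≡ m₀ + m₁ + (t₁ + t₂ + t₃)
    regroup = solve-∀
  trinomial-reflection (suc n) (suc h) = begin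
    t h + t (1 + h) + t (2 + h)
      ≡⟨ cong₂ _+_ (cong₂ _+_ (trinomial-reflection n h) (trinomial-reflection n (1 + h))) (trinomial-reflection n (2 + h)) ⟩
    (m h + t (2 + h)) + (m (1 + h) + t (3 + h)) + (m (2 + h) + t (4 + h))
      ≡⟨ regroup (m h) (t (2 + h)) (m (1 + h)) (t (3 + h)) (m (2 + h)) (t (4 + h)) ⟩
    m h + m (1 + h) + m (2 + h) + (t (2 + h) + t (3 + h) + t (4 + h))
      ∎
    where
    t = trinomial n
    m = motzkin n
    regroup : ∀ m₀ t₂ m₁ t₃ m₂ t₄ → m₀ + t₂ + (m₁ + t₃) + (m₂ + t₄) ≡ m₀ + m₁ + m₂ + (t₂ + t₃ + t₄)
    regroup = solve-∀

  -- multinomial n a b counts the n-step paths with a down-steps and b up-steps.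
  multinomial : ℕ → ℕ → ℕ → ℕ
  multinomial n a b = (n C a) * ((n ∸ a) C b)

  multinomial-vanishing : ∀ {n a} b → n < a → multinomial n a b ≡ 0
  multinomial-vanishing b n<a rewrite k>n⇒nCk≡0 n<a = refl

  multinomial-0-suc : ∀ n b → multinomial (suc n) 0 (suc b) ≡ multinomial n 0 b + multinomial n 0 (suc b)
  multinomial-0-suc n b = begin
    (suc n C suc b) + 0                  ≡⟨ +-identityʳ _ ⟩
    suc n C suc b                        ≡⟨ sym (nCk+nC[k+1]≡[n+1]C[k+1] n b) ⟩
    n C b + n C suc b                    ≡⟨ sym (cong₂ _+_ (+-identityʳ (n C b)) (+-identityʳ (n C suc b))) ⟩
    (n C b + 0) + (n C suc b + 0)        ∎

  multinomial-suc-0 : ∀ n a → multinomial (suc n) (suc a) 0 ≡ multinomial n a 0 + multinomial n (suc a) 0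
  multinomial-suc-0 n a = begin
    (suc n C suc a) * 1                  ≡⟨ *-identityʳ _ ⟩
    suc n C suc a                        ≡⟨ sym (nCk+nC[k+1]≡[n+1]C[k+1] n a) ⟩
    n C a + n C suc a                    ≡⟨ sym (cong₂ _+_ (*-identityʳ (n C a)) (*-identityʳ (n C suc a))) ⟩
    (n C a) * 1 + (n C suc a) * 1        ∎

  multinomial-pascal : ∀ n a b →
    multinomial (suc n) (suc a) (suc b) ≡ multinomial n a (suc b) + multinomial n (suc a) b + multinomial n (suc a) (suc b)
  multinomial-pascal n a b = begin
    (suc n C suc a) * ((n ∸ a) C suc b)
      ≡⟨ cong (_* ((n ∸ a) C suc b)) (sym (nCk+nC[k+1]≡[n+1]C[k+1] n a)) ⟩
    (n C a + n C suc a) * ((n ∸ a) C suc b)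
      ≡⟨ *-distribʳ-+ ((n ∸ a) C suc b) (n C a) (n C suc a) ⟩
    multinomial n a (suc b) + (n C suc a) * ((n ∸ a) C suc b)
      ≡⟨ cong (multinomial n a (suc b) +_) last-letter ⟩
    multinomial n a (suc b) + (multinomial n (suc a) b + multinomial n (suc a) (suc b))
      ≡⟨ sym (+-assoc (multinomial n a (suc b)) _ _) ⟩
    multinomial n a (suc b) + multinomial n (suc a) b + multinomial n (suc a) (suc b)
      ∎
    where
    vanishing : n < suc a → (n C suc a) * ((n ∸ a) C suc b) ≡ multinomial n (suc a) b + multinomial n (suc a) (suc b)
    vanishing n<1+a rewrite k>n⇒nCk≡0 n<1+a = refl

    last-letter : (n C suc a) * ((n ∸ a) C suc b) ≡ multinomial n (suc a) b + multinomial n (suc a) (suc b)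
    last-letter with <-cmp a n
    ... | tri< a<n _ _ = begin
      (n C suc a) * ((n ∸ a) C suc b)
        ≡⟨ cong (λ m → (n C suc a) * (m C suc b)) (+-∸-assoc 1 a<n) ⟩
      (n C suc a) * (suc (n ∸ suc a) C suc b)
        ≡⟨ cong ((n C suc a) *_) (sym (nCk+nC[k+1]≡[n+1]C[k+1] (n ∸ suc a) b)) ⟩
      (n C suc a) * ((n ∸ suc a) C b + (n ∸ suc a) C suc b)
        ≡⟨ *-distribˡ-+ (n C suc a) _ _ ⟩
      multinomial n (suc a) b + multinomial n (suc a) (suc b)
        ∎
    ... | tri≈ _ refl _ = vanishing (n<1+n n)
    ... | tri> _ _ n<a  = vanishing (m<n⇒m<1+n n<a)


  multinomial-comm : ∀ n a b → multinomial n a b ≡ multinomial n b a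
  multinomial-comm zero    zero    zero    = refl
  multinomial-comm zero    zero    (suc b) = refl
  multinomial-comm zero    (suc a) zero    = refl
  multinomial-comm zero    (suc a) (suc b) = refl
  multinomial-comm (suc n) zero    zero    = refl
  multinomial-comm (suc n) zero    (suc b) =
    trans (multinomial-0-suc n b)
          (trans (cong₂ _+_ (multinomial-comm n 0 b) (multinomial-comm n 0 (suc b))) (sym (multinomial-suc-0 n b)))
  multinomial-comm (suc n) (suc a) zero    =
    trans (multinomial-suc-0 n a)
          (trans (cong₂ _+_ (multinomial-comm n a 0) (multinomial-comm n (suc a) 0)) (sym (multinomial-0-suc n a)))
  multinomial-comm (suc n) (suc a) (suc b) = begin
    multinomial (suc n) (suc a) (suc b)
      ≡⟨ multinomial-pascal n a b ⟩
    multinomial n a (suc b) + multinomial n (suc a) b + multinomial n (suc a) (suc b)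
      ≡⟨ cong₂ _+_ (cong₂ _+_ (multinomial-comm n a (suc b)) (multinomial-comm n (suc a) b))
                   (multinomial-comm n (suc a) (suc b)) ⟩
    multinomial n (suc b) a + multinomial n b (suc a) + multinomial n (suc b) (suc a)
      ≡⟨ cong (_+ multinomial n (suc b) (suc a)) (+-comm (multinomial n (suc b) a) _) ⟩
    multinomial n b (suc a) + multinomial n (suc b) a + multinomial n (suc b) (suc a)
      ≡⟨ sym (multinomial-pascal n b a) ⟩
    multinomial (suc n) (suc b) (suc a)
      ∎

  diagonal : ℕ → ℕ → ℕ
  diagonal n h = ∑ (suc n) (λ k → multinomial n k (k + h))

  diagonal-extend : ∀ n h → ∑ (2 + n) (λ k → multinomial n k (k + h)) ≡ diagonal n h
  diagonal-extend n h = ∑-truncate _ (n≤1+n (suc n)) (λ i n<i _ → multinomial-vanishing (i + h) n<i)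

  diagonal-split : ∀ n h → diagonal (suc n) h ≡
    multinomial (suc n) 0 h + diagonal n (suc h) + (∑ (suc n) (λ k → multinomial n (suc k) (k + h))
                                                   + ∑ (suc n) (λ k → multinomial n (suc k) (suc k + h)))
  diagonal-split n h = begin
    multinomial (suc n) 0 h + ∑ (suc n) (λ k → multinomial (suc n) (suc k) (suc (k + h)))
      ≡⟨ cong (multinomial (suc n) 0 h +_) (begin
           ∑ (suc n) (λ k → multinomial (suc n) (suc k) (suc (k + h)))
             ≡⟨ ∑-cong (suc n) (λ k _ → multinomial-pascal n k (k + h)) ⟩
           ∑ (suc n) (λ k → X k + Y′ k + Z′ k)
             ≡⟨ trans (∑-distrib-+ (suc n) (λ k → X k + Y′ k) Z′) (cong (_+ Z) (∑-distrib-+ (suc n) X Y′)) ⟩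
           ∑ (suc n) X + Y + Z
             ∎) ⟩
    multinomial (suc n) 0 h + (∑ (suc n) X + Y + Z)
      ≡⟨ cong (λ x → multinomial (suc n) 0 h + (x + Y + Z))
              (∑-cong (suc n) (λ k _ → cong (multinomial n k) (sym (+-suc k h)))) ⟩
    multinomial (suc n) 0 h + (diagonal n (suc h) + Y + Z)
      ≡⟨ regroup (multinomial (suc n) 0 h) (diagonal n (suc h)) Y Z ⟩
    multinomial (suc n) 0 h + diagonal n (suc h) + (Y + Z)
      ∎
    where
    X Y′ Z′ : ℕ → ℕ
    X  k = multinomial n k (suc (k + h))
    Y′ k = multinomial n (suc k) (k + h)
    Z′ k = multinomial n (suc k) (suc k + h)
    Y = ∑ (suc n) Y′
    Z = ∑ (suc n) Z′
    regroup : ∀ a b c d → a + (b + c + d) ≡ a + b + (c + d)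
    regroup = solve-∀

  diagonal-suc-zero : ∀ n → diagonal (suc n) 0 ≡ diagonal n 1 + diagonal n 0 + diagonal n 1
  diagonal-suc-zero n = begin
    diagonal (suc n) 0
      ≡⟨ diagonal-split n 0 ⟩
    1 + diagonal n 1 + (∑ (suc n) (λ k → multinomial n (suc k) (k + 0)) + Z)
      ≡⟨ cong (λ x → 1 + diagonal n 1 + (x + Z)) (∑-cong (suc n) (λ k _ → mirror k)) ⟩
    1 + diagonal n 1 + (diagonal n 1 + Z)
      ≡⟨ regroup (diagonal n 1) Z ⟩
    diagonal n 1 + (1 + Z) + diagonal n 1
      ≡⟨ cong (λ x → diagonal n 1 + x + diagonal n 1) (diagonal-extend n 0) ⟩
    diagonal n 1 + diagonal n 0 + diagonal n 1
      ∎
    where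
    Z = ∑ (suc n) (λ k → multinomial n (suc k) (suc k + 0))
    mirror : ∀ k → multinomial n (suc k) (k + 0) ≡ multinomial n k (k + 1)
    mirror k = trans (multinomial-comm n (suc k) (k + 0))
                     (cong₂ (multinomial n) (+-identityʳ k) (sym (+-comm k 1)))
    regroup : ∀ d z → 1 + d + (d + z) ≡ d + (1 + z) + d
    regroup = solve-∀

  diagonal-suc-suc : ∀ n h → diagonal (suc n) (suc h) ≡ diagonal n h + diagonal n (suc h) + diagonal n (2 + h)
  diagonal-suc-suc n h = begin
    diagonal (suc n) (suc h)
      ≡⟨ diagonal-split n (suc h) ⟩
    multinomial (suc n) 0 (suc h) + diagonal n (2 + h) + (∑ (suc n) (λ k → multinomial n (suc k) (k + suc h)) + Z)
      ≡⟨ cong₂ (λ a x → a + diagonal n (2 + h) + (x + Z)) (multinomial-0-suc n h)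
                                                          (∑-cong (suc n) (λ k _ → cong (multinomial n (suc k)) (+-suc k h))) ⟩
    multinomial n 0 h + multinomial n 0 (suc h) + diagonal n (2 + h) + (Y + Z)
      ≡⟨ regroup (multinomial n 0 h) (multinomial n 0 (suc h)) (diagonal n (2 + h)) Y Z ⟩
    (multinomial n 0 h + Y) + (multinomial n 0 (suc h) + Z) + diagonal n (2 + h)
      ≡⟨ cong₂ (λ a b → a + b + diagonal n (2 + h)) (diagonal-extend n h) (diagonal-extend n (suc h)) ⟩
    diagonal n h + diagonal n (suc h) + diagonal n (2 + h)
      ∎
    where
    Y = ∑ (suc n) (λ k → multinomial n (suc k) (suc k + h))
    Z = ∑ (suc n) (λ k → multinomial n (suc k) (suc k + suc h))
    regroup : ∀ a b d y z → a + b + d + (y + z) ≡ a + y + (b + z) + d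
    regroup = solve-∀

  trinomial≡diagonal : ∀ n h → trinomial n h ≡ diagonal n h
  trinomial≡diagonal zero    zero    = refl
  trinomial≡diagonal zero    (suc h) = refl
  trinomial≡diagonal (suc n) zero    =
    trans (cong₂ (λ a b → a + b + a) (trinomial≡diagonal n 1) (trinomial≡diagonal n 0)) (sym (diagonal-suc-zero n))
  trinomial≡diagonal (suc n) (suc h) =
    trans (cong₂ _+_ (cong₂ _+_ (trinomial≡diagonal n h) (trinomial≡diagonal n (suc h))) (trinomial≡diagonal n (2 + h)))
          (sym (diagonal-suc-suc n h))

  T≡trinomial : ∀ n → T n ≡ trinomial n 0
  T≡trinomial n = begin
    listSum (map (λ k → (n C k) * ((n ∸ k) C k)) (upTo (suc n))) ≡⟨ listSum-applyUpTo (λ k → multinomial n k k) (λ k → k) (suc n) ⟩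
    ∑ (suc n) (λ k → multinomial n k k)                           ≡⟨ ∑-cong (suc n) (λ k _ → cong (multinomial n k) (sym (+-identityʳ k))) ⟩
    diagonal n 0                                                  ≡⟨ sym (trinomial≡diagonal n 0) ⟩
    trinomial n 0                                                 ∎

  -- A path of n + 1 steps ending at level a + b + 1 splits at its last visit to level a.
  conv-motzkin : ∀ (X : ℕ → ℕ → ℕ) → (∀ h → X 0 h ≡ motzkin 0 h) →
                 (∀ n h → X (suc n) (suc h) ≡ X n h + X n (suc h) + X n (2 + h)) →
                 ∀ n a b → conv (λ j → X j a) (λ l → motzkin l b) n ≡ X (suc n) (suc (a + b))
  conv-motzkin X X₀ X-step zero a b = begin
    X 0 a * motzkin 0 b
      ≡⟨ cong (_* motzkin 0 b) (X₀ a) ⟩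
    motzkin 0 a * motzkin 0 b
      ≡⟨ initial a b ⟩
    motzkin 0 (a + b) + motzkin 0 (suc (a + b)) + motzkin 0 (2 + (a + b))
      ≡⟨ sym (cong₂ _+_ (cong₂ _+_ (X₀ (a + b)) (X₀ (suc (a + b)))) (X₀ (2 + (a + b)))) ⟩
    X 0 (a + b) + X 0 (suc (a + b)) + X 0 (2 + (a + b))
      ≡⟨ sym (X-step 0 (a + b)) ⟩
    X 1 (suc (a + b))
      ∎
    where
    initial : ∀ a b → motzkin 0 a * motzkin 0 b ≡ motzkin 0 (a + b) + motzkin 0 (suc (a + b)) + motzkin 0 (2 + (a + b))
    initial zero    zero    = refl
    initial zero    (suc b) = refl
    initial (suc a) b       = refl
  conv-motzkin X X₀ X-step (suc n) a zero = begin
    conv (λ j → X j a) (λ l → motzkin l 0 + motzkin l 1) n + X (suc n) a * 1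
      ≡⟨ cong (_+ X (suc n) a * 1) (conv-distribʳ n (λ j → X j a) (λ l → motzkin l 0) (λ l → motzkin l 1)) ⟩
    conv (λ j → X j a) (λ l → motzkin l 0) n + conv (λ j → X j a) (λ l → motzkin l 1) n + X (suc n) a * 1
      ≡⟨ cong₂ (λ p q → p + q + X (suc n) a * 1) (conv-motzkin X X₀ X-step n a 0) (conv-motzkin X X₀ X-step n a 1) ⟩
    X (suc n) (suc (a + 0)) + X (suc n) (suc (a + 1)) + X (suc n) a * 1
      ≡⟨ cong₂ (λ p q → X (suc n) (suc p) + X (suc n) (suc q) + X (suc n) a * 1) (+-identityʳ a) (+-comm a 1) ⟩
    X (suc n) (suc a) + X (suc n) (2 + a) + X (suc n) a * 1
      ≡⟨ regroup (X (suc n) (suc a)) (X (suc n) (2 + a)) (X (suc n) a) ⟩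
    X (suc n) a + X (suc n) (suc a) + X (suc n) (2 + a)
      ≡⟨ sym (X-step (suc n) a) ⟩
    X (2 + n) (suc a)
      ≡⟨ cong (λ p → X (2 + n) (suc p)) (sym (+-identityʳ a)) ⟩
    X (2 + n) (suc (a + 0))
      ∎
    where regroup : ∀ x₁ x₂ x₀ → x₁ + x₂ + x₀ * 1 ≡ x₀ + x₁ + x₂
          regroup = solve-∀
  conv-motzkin X X₀ X-step (suc n) a (suc b) = begin
    conv (λ j → X j a) (λ l → motzkin l b + motzkin l (suc b) + motzkin l (2 + b)) n + X (suc n) a * 0
      ≡⟨ cong₂ _+_ (trans (conv-distribʳ n (λ j → X j a) (λ l → motzkin l b + motzkin l (suc b)) (λ l → motzkin l (2 + b)))
                          (cong (_+ conv (λ j → X j a) (λ l → motzkin l (2 + b)) n)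
                                (conv-distribʳ n (λ j → X j a) (λ l → motzkin l b) (λ l → motzkin l (suc b)))))
                   (*-zeroʳ (X (suc n) a)) ⟩
    conv (λ j → X j a) (λ l → motzkin l b) n + conv (λ j → X j a) (λ l → motzkin l (suc b)) n
      + conv (λ j → X j a) (λ l → motzkin l (2 + b)) n + 0
      ≡⟨ cong (_+ 0) (cong₂ _+_ (cong₂ _+_ (conv-motzkin X X₀ X-step n a b) (conv-motzkin X X₀ X-step n a (suc b)))
                                (conv-motzkin X X₀ X-step n a (2 + b))) ⟩
    X (suc n) (suc (a + b)) + X (suc n) (suc (a + suc b)) + X (suc n) (suc (a + (2 + b))) + 0
      ≡⟨ +-identityʳ _ ⟩
    X (suc n) (suc (a + b)) + X (suc n) (suc (a + suc b)) + X (suc n) (suc (a + (2 + b)))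
      ≡⟨ cong₂ (λ p q → X (suc n) (suc (a + b)) + X (suc n) (suc p) + X (suc n) (suc q))
               (+-suc a b) (trans (+-suc a (suc b)) (cong suc (+-suc a b))) ⟩
    X (suc n) (suc (a + b)) + X (suc n) (2 + (a + b)) + X (suc n) (3 + (a + b))
      ≡⟨ sym (X-step (suc n) (suc (a + b))) ⟩
    X (2 + n) (2 + (a + b))
      ≡⟨ cong (λ p → X (2 + n) (suc p)) (sym (+-suc a b)) ⟩
    X (2 + n) (suc (a + suc b))
      ∎

  conv-trinomial-motzkin : ∀ n a b → conv (λ j → trinomial j a) (λ l → motzkin l b) n ≡ trinomial (suc n) (suc (a + b))
  conv-trinomial-motzkin = conv-motzkin trinomial initial (λ _ _ → refl)
    where initial : ∀ h → trinomial 0 h ≡ motzkin 0 h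
          initial zero    = refl
          initial (suc h) = refl

  conv-motzkin-motzkin : ∀ n a b → conv (λ j → motzkin j a) (λ l → motzkin l b) n ≡ motzkin (suc n) (suc (a + b))
  conv-motzkin-motzkin = conv-motzkin motzkin (λ _ → refl) (λ _ _ → refl)

open Trinomial

-- A module only to keep ℕ's _+_ and _*_ out of scope at the ℤ statement at the end.
module SemiperimeterSum where

  open import Algebra.Structures.Biased using (isCommutativeSemiringˡ; isCommutativeMonoidˡ)
  open import Data.Nat using (_+_; _*_; _∸_; _⊓_; _/_; _≤ᵇ_)
  open import Data.Nat.DivMod using (m*n/n≡m)
  open import Data.Nat.ListAction using (sum)
  open import Data.Nat.Properties
    using (+-comm; +-assoc; +-identityʳ; *-assoc; *-comm; *-distribˡ-+; *-distribʳ-+; ⊓-comm; m⊓n+n∸m≡n;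
           m+n∸n≡m; m+[n∸m]≡n; m≤n⇒m∸n≡0; ≤-trans; ≤-antisym; ≤-reflexive; ≤-<-trans; ≤-pred; n≤1+n; +-suc;
           +-monoˡ-≤; ≤ᵇ-reflects-≤; ≰⇒>; <⇒≱)
  open import Data.Nat.Tactic.RingSolver using (solve-∀; solve)
  open import Data.Product using (_×_; proj₁; proj₂)
  open import Relation.Binary.PropositionalEquality.Algebra using (isMagma)

  -- (a , a′) is the dual number a + a′ε with ε² = 0.  A weight w is recorded as y^ w, the
  -- value of yʷ at y = 1 + ε, so the ε-part of a sum of such monomials is the total weight.
  Dual : Set
  Dual = ℕ × ℕ

  infixl 6 _⊕_
  infixl 7 _⊗_

  _⊕_ _⊗_ : Op₂ Dual
  (a , a′) ⊕ (b , b′) = (a + b , a′ + b′)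
  (a , a′) ⊗ (b , b′) = (a * b , a * b′ + a′ * b)

  0ᴰ 1ᴰ : Dual
  0ᴰ = (0 , 0)
  1ᴰ = (1 , 0)

  y^_ : ℕ → Dual
  y^ w = (1 , w)

  y y² : Dual
  y  = y^ 1
  y² = y^ 2

  y^-+ : ∀ a b → y^ (a + b) ≡ y^ a ⊗ y^ b
  y^-+ a b = cong (1 ,_) (exponents a b)
    where exponents : ∀ a b → a + b ≡ 1 * b + a * 1
          exponents = solve-∀

  ⊕-⊗-isCommutativeSemiring : IsCommutativeSemiring _≡_ _⊕_ _⊗_ 0ᴰ 1ᴰ
  ⊕-⊗-isCommutativeSemiring = isCommutativeSemiringˡ record
    { +-isCommutativeMonoid = isCommutativeMonoidˡ record
      { isSemigroup = record { isMagma = isMagma _⊕_ ; assoc = ⊕-assoc }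
      ; identityˡ   = λ _ → refl
      ; comm        = ⊕-comm
      }
    ; *-isCommutativeMonoid = isCommutativeMonoidˡ record
      { isSemigroup = record { isMagma = isMagma _⊗_ ; assoc = ⊗-assoc }
      ; identityˡ   = ⊗-identityˡ
      ; comm        = ⊗-comm
      }
    ; distribʳ = ⊗-distribʳ
    ; zeroˡ    = λ _ → refl
    }
    where
    ⊕-assoc : ∀ x y z → x ⊕ y ⊕ z ≡ x ⊕ (y ⊕ z)
    ⊕-assoc (a , a′) (b , b′) (c , c′) = cong₂ _,_ (+-assoc a b c) (+-assoc a′ b′ c′)

    ⊕-comm : ∀ x y → x ⊕ y ≡ y ⊕ x
    ⊕-comm (a , a′) (b , b′) = cong₂ _,_ (+-comm a b) (+-comm a′ b′)

    ⊗-assoc : ∀ x y z → x ⊗ y ⊗ z ≡ x ⊗ (y ⊗ z)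
    ⊗-assoc (a , a′) (b , b′) (c , c′) = cong₂ _,_ (*-assoc a b c) (ε-part a a′ b b′ c c′)
      where ε-part : ∀ a a′ b b′ c c′ → a * b * c′ + (a * b′ + a′ * b) * c ≡ a * (b * c′ + b′ * c) + a′ * (b * c)
            ε-part = solve-∀

    ⊗-identityˡ : ∀ x → 1ᴰ ⊗ x ≡ x
    ⊗-identityˡ (a , a′) = cong₂ _,_ (+-identityʳ a) (ε-part a a′)
      where ε-part : ∀ a a′ → 1 * a′ + 0 * a ≡ a′
            ε-part = solve-∀

    ⊗-comm : ∀ x y → x ⊗ y ≡ y ⊗ x
    ⊗-comm (a , a′) (b , b′) = cong₂ _,_ (*-comm a b) (ε-part a a′ b b′)
      where ε-part : ∀ a a′ b b′ → a * b′ + a′ * b ≡ b * a′ + b′ * a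
            ε-part = solve-∀

    ⊗-distribʳ : ∀ z x y → (x ⊕ y) ⊗ z ≡ x ⊗ z ⊕ y ⊗ z
    ⊗-distribʳ (c , c′) (a , a′) (b , b′) = cong₂ _,_ (*-distribʳ-+ c a b) (ε-part a a′ b b′ c c′)
      where ε-part : ∀ a a′ b b′ c c′ → (a + b) * c′ + (a′ + b′) * c ≡ a * c′ + a′ * c + (b * c′ + b′ * c)
            ε-part = solve-∀

  open IsCommutativeSemiring ⊕-⊗-isCommutativeSemiring
    using () renaming (+-comm to ⊕-comm; +-assoc to ⊕-assoc; +-identityʳ to ⊕-identityʳ;
                       *-identityˡ to ⊗-identityˡ; distribˡ to ⊗-distribˡ; zeroʳ to ⊗-zeroʳ)
  open Series ⊕-⊗-isCommutativeSemiring
    hiding (_+_; _*_) renaming (+-middleFour to ⊕-middleFour; *-leftComm to ⊗-leftComm)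

  sper′ : List ℕ → ℕ
  sper′ []           = 0
  sper′ (x ∷ [])     = 2 + x
  sper′ (x ∷ y ∷ ys) = suc ((x ∸ y) + sper′ (y ∷ ys))

  4*area≡2*sper′+2*sharedEdges : ∀ w → 4 * area w ≡ 2 * sper′ w + 2 * sharedEdges w
  4*area≡2*sper′+2*sharedEdges []           = refl
  4*area≡2*sper′+2*sharedEdges (x ∷ [])     = single x
    where single : ∀ x → 4 * (suc x + 0) ≡ 2 * (2 + x) + 2 * (x + 0 + 0)
          single = solve-∀
  4*area≡2*sper′+2*sharedEdges (x ∷ y ∷ ys) = begin
    4 * (suc x + area (y ∷ ys))
      ≡⟨ *-distribˡ-+ 4 (suc x) _ ⟩
    4 * suc x + 4 * area (y ∷ ys)
      ≡⟨ cong₂ _+_ firstColumn (4*area≡2*sper′+2*sharedEdges (y ∷ ys)) ⟩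
    2 * suc (x ∸ y) + 2 * (x + m) + (2 * sper′ (y ∷ ys) + 2 * (sum (y ∷ ys) + horizAdj (y ∷ ys)))
      ≡⟨ regroup (x ∸ y) x m (sper′ (y ∷ ys)) (sum (y ∷ ys)) (horizAdj (y ∷ ys)) ⟩
    2 * sper′ (x ∷ y ∷ ys) + 2 * sharedEdges (x ∷ y ∷ ys)
      ∎
    where
    open ≡-Reasoning
    m = suc x ⊓ suc y

    m+[x∸y]≡1+x : m + (x ∸ y) ≡ suc x
    m+[x∸y]≡1+x = trans (cong (_+ (x ∸ y)) (⊓-comm (suc x) (suc y))) (m⊓n+n∸m≡n (suc y) (suc x))

    firstColumn : 4 * suc x ≡ 2 * suc (x ∸ y) + 2 * (x + m)
    firstColumn = begin
      4 * suc x                        ≡⟨ double (suc x) ⟩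
      2 * suc x + 2 * suc x            ≡⟨ cong (λ t → 2 * suc x + 2 * t) (sym m+[x∸y]≡1+x) ⟩
      2 * suc x + 2 * (m + (x ∸ y))    ≡⟨ shuffle x m (x ∸ y) ⟩
      2 * suc (x ∸ y) + 2 * (x + m)    ∎
      where
      double : ∀ a → 4 * a ≡ 2 * a + 2 * a
      double = solve-∀
      shuffle : ∀ x m d → 2 * suc x + 2 * (m + d) ≡ 2 * suc d + 2 * (x + m)
      shuffle = solve-∀

    regroup : ∀ d x m P S H → 2 * suc d + 2 * (x + m) + (2 * P + 2 * (S + H)) ≡ 2 * suc (d + P) + 2 * (x + S + (m + H))
    regroup = solve-∀

  sper≡sper′ : ∀ w → sper w ≡ sper′ w
  sper≡sper′ w = begin
    (4 * area w ∸ 2 * sharedEdges w) / 2                    ≡⟨ cong (λ t → (t ∸ 2 * sharedEdges w) / 2) (4*area≡2*sper′+2*sharedEdges w) ⟩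
    (2 * sper′ w + 2 * sharedEdges w ∸ 2 * sharedEdges w) / 2 ≡⟨ cong (_/ 2) (m+n∸n≡m (2 * sper′ w) (2 * sharedEdges w)) ⟩
    (2 * sper′ w) / 2                                       ≡⟨ cong (_/ 2) (*-comm 2 (sper′ w)) ⟩
    (sper′ w * 2) / 2                                       ≡⟨ m*n/n≡m (sper′ w) 2 ⟩
    sper′ w                                                 ∎
    where open ≡-Reasoning

  stepWeight : ℕ → List ℕ → ℕ
  stepWeight x []      = 0
  stepWeight x (i ∷ w) = (if i ≤ᵇ x then 1 else 2) + stepWeight i w

  sper′≡2+x+stepWeight : ∀ x w → IsTrue (stepsOK (x ∷ w)) → sper′ (x ∷ w) ≡ 2 + x + stepWeight x w
  sper′≡2+x+stepWeight x []      _ = sym (+-identityʳ (2 + x))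
  sper′≡2+x+stepWeight x (i ∷ w) ok
    with i ≤ᵇ suc x | ≤ᵇ-reflects-≤ i (suc x) | i ≤ᵇ x | ≤ᵇ-reflects-≤ i x
  ... | false | _          | _     | _        = ⊥-elim ok
  ... | true  | _          | true  | ofʸ i≤x  = begin
    suc ((x ∸ i) + sper′ (i ∷ w))            ≡⟨ cong (λ t → suc ((x ∸ i) + t)) (sper′≡2+x+stepWeight i w ok) ⟩
    suc ((x ∸ i) + (2 + i + stepWeight i w)) ≡⟨ regroup (x ∸ i) i (stepWeight i w) ⟩
    2 + (i + (x ∸ i)) + (1 + stepWeight i w) ≡⟨ cong (λ t → 2 + t + (1 + stepWeight i w)) (m+[n∸m]≡n i≤x) ⟩
    2 + x + (1 + stepWeight i w)             ∎
    where
    open ≡-Reasoning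
    regroup : ∀ d i W → suc (d + (2 + i + W)) ≡ 2 + (i + d) + (1 + W)
    regroup = solve-∀
  ... | true  | ofʸ i≤1+x | false | ofⁿ i≰x = begin
    suc ((x ∸ i) + sper′ (i ∷ w))            ≡⟨ cong₂ (λ d t → suc (d + t)) (m≤n⇒m∸n≡0 (≤-trans (n≤1+n x) (≰⇒> i≰x)))
                                                                           (sper′≡2+x+stepWeight i w ok) ⟩
    suc (0 + (2 + i + stepWeight i w))       ≡⟨ cong (λ t → suc (2 + t + stepWeight i w)) (≤-antisym i≤1+x (≰⇒> i≰x)) ⟩
    suc (2 + suc x + stepWeight i w)         ≡⟨ regroup x (stepWeight i w) ⟩
    2 + x + (2 + stepWeight i w)             ∎
    where
    open ≡-Reasoning
    regroup : ∀ x W → suc (2 + suc x + W) ≡ 2 + x + (2 + W)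
    regroup = solve-∀

  -- After a weak descent the next letter must be an ascent, or (≥,≥) would occur.
  data Mode : Set where
    free forced : Mode

  modeAfter : ℕ → ℕ → Mode
  modeAfter x i = if i ≤ᵇ x then forced else free

  accepts : ℕ → Mode → List ℕ → Bool
  accepts x m      []      = true
  accepts x free   (i ∷ w) = (i ≤ᵇ suc x) ∧ accepts i (modeAfter x i) w
  accepts x forced (i ∷ w) = ((i ≤ᵇ suc x) ∧ not (i ≤ᵇ x)) ∧ accepts i free w

  avoidsGeGe-afterAscent : ∀ p x w → (x ≤ᵇ p) ≡ false → avoidsGeGe (p ∷ x ∷ w) ≡ avoidsGeGe (x ∷ w)
  avoidsGeGe-afterAscent p x []      _    = refl
  avoidsGeGe-afterAscent p x (i ∷ w) x≰ᵇp rewrite x≰ᵇp = refl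

  mutual
    accepts-correct : ∀ x w → stepsOK (x ∷ w) ∧ avoidsGeGe (x ∷ w) ≡ accepts x free w
    accepts-correct x []      = refl
    accepts-correct x (i ∷ w) =
      trans (∧-assoc (i ≤ᵇ suc x) _ _) (cong ((i ≤ᵇ suc x) ∧_) (accepts-correct-after x i w))

    accepts-correct-after : ∀ p x w → stepsOK (x ∷ w) ∧ avoidsGeGe (p ∷ x ∷ w) ≡ accepts x (modeAfter p x) w
    accepts-correct-after p x w with x ≤ᵇ p in x≤ᵇp
    ... | true  = accepts-correct-forced p x w x≤ᵇp
    ... | false = trans (cong (stepsOK (x ∷ w) ∧_) (avoidsGeGe-afterAscent p x w x≤ᵇp)) (accepts-correct x w)

    accepts-correct-forced : ∀ p x w → (x ≤ᵇ p) ≡ true → stepsOK (x ∷ w) ∧ avoidsGeGe (p ∷ x ∷ w) ≡ accepts x forced w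
    accepts-correct-forced p x []      _   = refl
    accepts-correct-forced p x (i ∷ w) x≤ᵇp rewrite x≤ᵇp with i ≤ᵇ suc x
    ... | false = refl
    ... | true with i ≤ᵇ x in i≤ᵇx
    ...   | true  = ∧-zeroʳ (stepsOK (i ∷ w))
    ...   | false = trans (cong (stepsOK (i ∷ w) ∧_) (avoidsGeGe-afterAscent x i w i≤ᵇx)) (accepts-correct i w)

  -- Weighted count of the k-letter continuations of a word ending with the letter x in mode m:
  -- an ascent weighs y², a weak descent y, and φ weighs the final letter and mode.
  walks : (ℕ → Mode → Dual) → ℕ → Mode → ℕ → Dual
  walks φ x m      zero    = φ x m
  walks φ x free   (suc k) = y² ⊗ walks φ (suc x) free k ⊕ y ⊗ ∑ (suc x) (λ i → walks φ i forced k)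
  walks φ x forced (suc k) = y² ⊗ walks φ (suc x) free k

  allEnds : ℕ → Mode → Dual
  allEnds _ _ = 1ᴰ

  allWalks : ℕ → Dual
  allWalks = walks allEnds 0 free

  walkValue : ℕ → Mode → List ℕ → Dual
  walkValue x m w = if accepts x m w then y^ (stepWeight x w) else 0ᴰ

  ≤ᵇ-true : ∀ {m n} → m ≤ n → (m ≤ᵇ n) ≡ true
  ≤ᵇ-true {m} {n} m≤n with m ≤ᵇ n | ≤ᵇ-reflects-≤ m n
  ... | true  | _       = refl
  ... | false | ofⁿ m≰n = contradiction m≤n m≰n

  ≤ᵇ-false : ∀ {m n} → n < m → (m ≤ᵇ n) ≡ false
  ≤ᵇ-false {m} {n} n<m with m ≤ᵇ n | ≤ᵇ-reflects-≤ m n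
  ... | false | _       = refl
  ... | true  | ofʸ m≤n = contradiction m≤n (<⇒≱ n<m)

  if-y^-+ : ∀ b a c → (if b then y^ (a + c) else 0ᴰ) ≡ y^ a ⊗ (if b then y^ c else 0ᴰ)
  if-y^-+ true  a c = y^-+ a c
  if-y^-+ false a c = sym (⊗-zeroʳ (y^ a))

  walkValue-descent : ∀ {x i} w → i ≤ x → walkValue x free (i ∷ w) ≡ y ⊗ walkValue i forced w
  walkValue-descent {x} {i} w i≤x rewrite ≤ᵇ-true (m≤n⇒m≤1+n i≤x) | ≤ᵇ-true i≤x =
    if-y^-+ (accepts i forced w) 1 (stepWeight i w)

  walkValue-forcedDescent : ∀ {x i} w → i ≤ x → walkValue x forced (i ∷ w) ≡ 0ᴰ
  walkValue-forcedDescent {x} {i} w i≤x rewrite ≤ᵇ-true (m≤n⇒m≤1+n i≤x) | ≤ᵇ-true i≤x = refl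

  walkValue-ascent : ∀ {x} m w → walkValue x m (suc x ∷ w) ≡ y² ⊗ walkValue (suc x) free w
  walkValue-ascent {x} free   w rewrite ≤ᵇ-true (≤-refl {suc x}) | ≤ᵇ-false (≤-refl {suc x}) =
    if-y^-+ (accepts (suc x) free w) 2 (stepWeight (suc x) w)
  walkValue-ascent {x} forced w rewrite ≤ᵇ-true (≤-refl {suc x}) | ≤ᵇ-false (≤-refl {suc x}) =
    if-y^-+ (accepts (suc x) free w) 2 (stepWeight (suc x) w)

  walkValue-jump : ∀ {x i} m w → suc x < i → walkValue x m (i ∷ w) ≡ 0ᴰ
  walkValue-jump {x} {i} free   w 1+x<i rewrite ≤ᵇ-false 1+x<i = refl
  walkValue-jump {x} {i} forced w 1+x<i rewrite ≤ᵇ-false 1+x<i = refl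

  -- A continuation of length k from x only uses letters up to x + k, all of them below n.
  listSum-walkValue≡walks : ∀ k x m n → x + k < n → listSum (map (walkValue x m) (allLists n k)) ≡ walks allEnds x m k
  listSum-walkValue≡walks zero    x m n _        = refl
  listSum-walkValue≡walks (suc k) x m n x+1+k<n = begin
    listSum (map (walkValue x m) (allLists n (suc k)))
      ≡⟨ listSum-allLists n k (walkValue x m) ⟩
    ∑ n term
      ≡⟨ ∑-truncate term 2+x≤n (λ i 2+x≤i _ → listSum-vanishing L (λ w → walkValue-jump m w 2+x≤i)) ⟩
    ∑ (suc (suc x)) term
      ≡⟨ ∑-last (suc x) term ⟩
    ∑ (suc x) term ⊕ term (suc x)
      ≡⟨ cong₂ _⊕_ (∑-cong (suc x) (λ i i<1+x → descent m (≤-pred i<1+x))) (ascent m) ⟩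
    ∑ (suc x) (afterDescent m) ⊕ y² ⊗ walks allEnds (suc x) free k
      ≡⟨ collect m ⟩
    walks allEnds x m (suc k)
      ∎
    where
    open ≡-Reasoning
    L = allLists n k

    term : ℕ → Dual
    term i = listSum (map (walkValue x m ∘ (i ∷_)) L)

    2+x≤n : suc (suc x) ≤ n
    2+x≤n = ≤-trans (s≤s (≤-trans (s≤s (m≤m+n x k)) (≤-reflexive (sym (+-suc x k))))) x+1+k<n

    shorter : ∀ {i} m′ → i ≤ suc x → listSum (map (walkValue i m′) L) ≡ walks allEnds i m′ k
    shorter {i} m′ i≤1+x = listSum-walkValue≡walks k i m′ n
      (≤-<-trans (≤-trans (+-monoˡ-≤ k i≤1+x) (≤-reflexive (sym (+-suc x k)))) x+1+k<n)

    afterDescent : Mode → ℕ → Dual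
    afterDescent free   i = y ⊗ walks allEnds i forced k
    afterDescent forced i = 0ᴰ

    descent : ∀ m′ {i} → i ≤ x → listSum (map (walkValue x m′ ∘ (i ∷_)) L) ≡ afterDescent m′ i
    descent free   {i} i≤x = begin
      listSum (map (walkValue x free ∘ (i ∷_)) L)       ≡⟨ cong listSum (map-cong (λ w → walkValue-descent w i≤x) L) ⟩
      listSum (map (λ w → y ⊗ walkValue i forced w) L) ≡⟨ sym (*-distribˡ-listSum y (walkValue i forced) L) ⟩
      y ⊗ listSum (map (walkValue i forced) L)         ≡⟨ cong (y ⊗_) (shorter forced (m≤n⇒m≤1+n i≤x)) ⟩
      y ⊗ walks allEnds i forced k                     ∎
    descent forced     i≤x = listSum-vanishing L (λ w → walkValue-forcedDescent w i≤x)

    ascent : ∀ m′ → listSum (map (walkValue x m′ ∘ (suc x ∷_)) L) ≡ y² ⊗ walks allEnds (suc x) free k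
    ascent m′ = begin
      listSum (map (walkValue x m′ ∘ (suc x ∷_)) L)         ≡⟨ cong listSum (map-cong (walkValue-ascent m′) L) ⟩
      listSum (map (λ w → y² ⊗ walkValue (suc x) free w) L) ≡⟨ sym (*-distribˡ-listSum y² (walkValue (suc x) free) L) ⟩
      y² ⊗ listSum (map (walkValue (suc x) free) L)         ≡⟨ cong (y² ⊗_) (shorter free ≤-refl) ⟩
      y² ⊗ walks allEnds (suc x) free k                     ∎

    collect : ∀ m′ → ∑ (suc x) (afterDescent m′) ⊕ y² ⊗ walks allEnds (suc x) free k ≡ walks allEnds x m′ (suc k)
    collect free   = trans (⊕-comm (∑ (suc x) (afterDescent free)) _)
                           (cong (y² ⊗ walks allEnds (suc x) free k ⊕_) (sym (*-distribˡ-∑ y (suc x) (λ i → walks allEnds i forced k))))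
    collect forced = cong (_⊕ y² ⊗ walks allEnds (suc x) free k) (∑-vanishing (suc x) (λ _ _ → refl))

  proj₂-listSum : ∀ {B : Set} (g : B → Dual) xs → proj₂ (listSum (map g xs)) ≡ sum (map (proj₂ ∘ g) xs)
  proj₂-listSum g []       = refl
  proj₂-listSum g (x ∷ xs) = cong (proj₂ (g x) +_) (proj₂-listSum g xs)

  s≡proj₂[y²⊗allWalks] : ∀ k → s (suc k) ≡ proj₂ (y² ⊗ allWalks k)
  s≡proj₂[y²⊗allWalks] k = begin
    sum (map sper (filter (λ w → T? (valid w)) (allLists (suc k) (suc k))))
      ≡⟨ ℕ-Series.listSum-filter (λ w → T? (valid w)) sper (allLists (suc k) (suc k)) ⟩
    sum (map counted (allLists (suc k) (suc k)))
      ≡⟨ ℕ-Series.listSum-allLists (suc k) k counted ⟩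
    sum (map (counted ∘ (0 ∷_)) L) + ℕ-Series.∑ k (λ i → sum (map (counted ∘ (suc i ∷_)) L))
      ≡⟨ cong (sum (map (counted ∘ (0 ∷_)) L) +_)
              (ℕ-Series.∑-vanishing k (λ i _ → ℕ-Series.listSum-vanishing L (λ _ → refl))) ⟩
    sum (map (counted ∘ (0 ∷_)) L) + 0
      ≡⟨ +-identityʳ _ ⟩
    sum (map (counted ∘ (0 ∷_)) L)
      ≡⟨ cong sum (map-cong counted-0∷ L) ⟩
    sum (map (λ w → proj₂ (y² ⊗ walkValue 0 free w)) L)
      ≡⟨ sym (proj₂-listSum (λ w → y² ⊗ walkValue 0 free w) L) ⟩
    proj₂ (listSum (map (λ w → y² ⊗ walkValue 0 free w) L))
      ≡⟨ cong proj₂ (sym (*-distribˡ-listSum y² (walkValue 0 free) L)) ⟩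
    proj₂ (y² ⊗ listSum (map (walkValue 0 free) L))
      ≡⟨ cong (λ t → proj₂ (y² ⊗ t)) (listSum-walkValue≡walks k 0 free (suc k) ≤-refl) ⟩
    proj₂ (y² ⊗ allWalks k)
      ∎
    where
    open ≡-Reasoning
    L = allLists (suc k) k

    valid : List ℕ → Bool
    valid w = isCatalan w ∧ avoidsGeGe w

    counted : List ℕ → ℕ
    counted w = if valid w then sper w else 0

    valid⇒stepsOK : ∀ w → stepsOK (0 ∷ w) ∧ avoidsGeGe (0 ∷ w) ≡ true → IsTrue (stepsOK (0 ∷ w))
    valid⇒stepsOK w ok with stepsOK (0 ∷ w)
    ... | true = tt

    counted-0∷ : ∀ w → counted (0 ∷ w) ≡ proj₂ (y² ⊗ walkValue 0 free w)
    counted-0∷ w rewrite accepts-correct 0 w with accepts 0 free w in accepted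
    ... | true  = begin
      sper (0 ∷ w)               ≡⟨ sper≡sper′ (0 ∷ w) ⟩
      sper′ (0 ∷ w)              ≡⟨ sper′≡2+x+stepWeight 0 w (valid⇒stepsOK w (trans (accepts-correct 0 w) accepted)) ⟩
      2 + stepWeight 0 w         ≡⟨ +-comm 2 (stepWeight 0 w) ⟩
      stepWeight 0 w + 2         ≡⟨ cong (_+ 2) (sym (+-identityʳ (stepWeight 0 w))) ⟩
      1 * stepWeight 0 w + 2 * 1 ∎
    ... | false = refl

  endsAtFloor : ℕ → Mode → Dual
  endsAtFloor _       free   = 0ᴰ
  endsAtFloor zero    forced = 1ᴰ
  endsAtFloor (suc _) forced = 0ᴰ

  escape : (Mode → Dual) → Mode → ℕ → Dual
  escape φ m zero    = φ m
  escape φ m (suc k) = y² ⊗ walks (λ _ → φ) 0 free k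

  avoidingFloor : (Mode → Dual) → ℕ → Mode → ℕ → Dual
  avoidingFloor φ zero    free   k = escape φ free k
  avoidingFloor φ zero    forced k = 0ᴰ
  avoidingFloor φ (suc x) m      k = walks (λ _ → φ) x m k

  -- Height 0 can only be re-entered by a descent, i.e. in mode forced.  Cut a walk at its last visit
  -- to (0, forced): the rest ascends to 1 and stays above 0, so it is a walk from (0, free) shifted
  -- up (escape).  A walk never visiting (0, forced) is likewise a walk from one level lower, shifted.
  last-passage : ∀ φ k x m →
    walks (λ _ → φ) x m k ≡ avoidingFloor φ x m k ⊕ conv (walks endsAtFloor x m) (escape φ forced) k
  last-passage φ zero    zero    free   = sym (⊕-identityʳ (φ free))
  last-passage φ zero    zero    forced = sym (⊗-identityˡ (φ forced))
  last-passage φ zero    (suc x) free   = sym (⊕-identityʳ (φ free))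
  last-passage φ zero    (suc x) forced = sym (⊕-identityʳ (φ forced))
  last-passage φ (suc k) x       free   = begin
    y² ⊗ W (suc x) free ⊕ y ⊗ ∑ (suc x) (λ i → W i forced)
      ≡⟨ cong₂ (λ a b → y² ⊗ a ⊕ y ⊗ b) (last-passage φ k (suc x) free)
                                        (∑-cong (suc x) (λ i _ → last-passage φ k i forced)) ⟩
    y² ⊗ (W x free ⊕ C (suc x) free) ⊕ y ⊗ ∑ (suc x) (λ i → A i forced ⊕ C i forced)
      ≡⟨ cong₂ (λ a b → a ⊕ y ⊗ b) (⊗-distribˡ y² (W x free) _) (∑-distrib-+ (suc x) (λ i → A i forced) (λ i → C i forced)) ⟩
    y² ⊗ W x free ⊕ y² ⊗ C (suc x) free ⊕ y ⊗ (ΣA ⊕ ΣC)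
      ≡⟨ cong (y² ⊗ W x free ⊕ y² ⊗ C (suc x) free ⊕_) (⊗-distribˡ y ΣA ΣC) ⟩
    y² ⊗ W x free ⊕ y² ⊗ C (suc x) free ⊕ (y ⊗ ΣA ⊕ y ⊗ ΣC)
      ≡⟨ ⊕-middleFour (y² ⊗ W x free) _ _ _ ⟩
    (y² ⊗ W x free ⊕ y ⊗ ΣA) ⊕ (y² ⊗ C (suc x) free ⊕ y ⊗ ΣC)
      ≡⟨ cong₂ _⊕_ (avoiding x) (sym toFloor) ⟩
    avoidingFloor φ x free (suc k) ⊕ conv (Z x free) ν (suc k)
      ∎
    where
    open ≡-Reasoning
    ν = escape φ forced
    W = λ x m → walks (λ _ → φ) x m k
    A = λ x m → avoidingFloor φ x m k
    Z = walks endsAtFloor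
    C = λ x m → conv (Z x m) ν k
    ΣA = ∑ (suc x) (λ i → A i forced)
    ΣC = ∑ (suc x) (λ i → C i forced)

    avoiding : ∀ x → y² ⊗ W x free ⊕ y ⊗ ∑ (suc x) (λ i → A i forced) ≡ avoidingFloor φ x free (suc k)
    avoiding zero    = ⊕-identityʳ (y² ⊗ W 0 free)
    avoiding (suc x) = refl

    toFloor : conv (Z x free) ν (suc k) ≡ y² ⊗ C (suc x) free ⊕ y ⊗ ΣC
    toFloor = begin
      conv (Z x free) ν (suc k)
        ≡⟨ conv-suc k (Z x free) ν ⟩
      conv (λ j → y² ⊗ Z (suc x) free j ⊕ y ⊗ ∑ (suc x) (λ i → Z i forced j)) ν k
        ≡⟨ conv-distribˡ k (λ j → y² ⊗ Z (suc x) free j) _ ν ⟩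
      conv (λ j → y² ⊗ Z (suc x) free j) ν k ⊕ conv (λ j → y ⊗ ∑ (suc x) (λ i → Z i forced j)) ν k
        ≡⟨ cong₂ _⊕_ (conv-scaleˡ k y² (Z (suc x) free) ν)
                     (trans (conv-scaleˡ k y (λ j → ∑ (suc x) (λ i → Z i forced j)) ν)
                            (cong (y ⊗_) (conv-∑ˡ (suc x) k (λ i → Z i forced) ν))) ⟩
      y² ⊗ C (suc x) free ⊕ y ⊗ ΣC
        ∎
  last-passage φ (suc k) x       forced = begin
    y² ⊗ W (suc x) free
      ≡⟨ cong (y² ⊗_) (last-passage φ k (suc x) free) ⟩
    y² ⊗ (W x free ⊕ conv (Z (suc x) free) ν k)
      ≡⟨ ⊗-distribˡ y² (W x free) _ ⟩
    y² ⊗ W x free ⊕ y² ⊗ conv (Z (suc x) free) ν k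
      ≡⟨ cong₂ _⊕_ (start x) (sym (conv-scaleˡ k y² (Z (suc x) free) ν)) ⟩
    avoidingFloor φ x forced (suc k) ⊕ Z x forced 0 ⊗ ν (suc k) ⊕ conv (λ j → y² ⊗ Z (suc x) free j) ν k
      ≡⟨ ⊕-assoc (avoidingFloor φ x forced (suc k)) _ _ ⟩
    avoidingFloor φ x forced (suc k) ⊕ (Z x forced 0 ⊗ ν (suc k) ⊕ conv (λ j → y² ⊗ Z (suc x) free j) ν k)
      ≡⟨ cong (avoidingFloor φ x forced (suc k) ⊕_) (sym (conv-suc k (Z x forced) ν)) ⟩
    avoidingFloor φ x forced (suc k) ⊕ conv (Z x forced) ν (suc k)
      ∎
    where
    open ≡-Reasoning
    ν = escape φ forced
    W = λ x m → walks (λ _ → φ) x m k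
    Z = walks endsAtFloor

    start : ∀ x → y² ⊗ W x free ≡ avoidingFloor φ x forced (suc k) ⊕ Z x forced 0 ⊗ ν (suc k)
    start zero    = sym (⊗-identityˡ (ν (suc k)))
    start (suc x) = sym (⊕-identityʳ (y² ⊗ W (suc x) free))

  endsFree : Mode → Dual
  endsFree free   = 1ᴰ
  endsFree forced = 0ᴰ

  walks-toFloor : ∀ k x m → walks endsAtFloor x m (suc k) ≡ y ⊗ walks (λ _ → endsFree) x m k
  walks-toFloor zero    x free   = cong (λ t → y ⊗ (1ᴰ ⊕ t)) (∑-vanishing x (λ _ _ → refl))
  walks-toFloor zero    x forced = refl
  walks-toFloor (suc k) x free   = begin
    y² ⊗ walks endsAtFloor (suc x) free (suc k) ⊕ y ⊗ ∑ (suc x) (λ i → walks endsAtFloor i forced (suc k))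
      ≡⟨ cong₂ (λ a b → y² ⊗ a ⊕ y ⊗ b) (walks-toFloor k (suc x) free)
                                        (∑-cong (suc x) (λ i _ → walks-toFloor k i forced)) ⟩
    y² ⊗ (y ⊗ V (suc x) free) ⊕ y ⊗ ∑ (suc x) (λ i → y ⊗ V i forced)
      ≡⟨ cong₂ (λ a b → a ⊕ y ⊗ b) (⊗-leftComm y² y (V (suc x) free))
                                   (sym (*-distribˡ-∑ y (suc x) (λ i → V i forced))) ⟩
    y ⊗ (y² ⊗ V (suc x) free) ⊕ y ⊗ (y ⊗ ∑ (suc x) (λ i → V i forced))
      ≡⟨ sym (⊗-distribˡ y (y² ⊗ V (suc x) free) (y ⊗ ∑ (suc x) (λ i → V i forced))) ⟩
    y ⊗ walks (λ _ → endsFree) x free (suc k)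
      ∎
    where
    open ≡-Reasoning
    V = λ x m → walks (λ _ → endsFree) x m k
  walks-toFloor (suc k) x forced =
    trans (cong (y² ⊗_) (walks-toFloor k (suc x) free)) (⊗-leftComm y² y (walks (λ _ → endsFree) (suc x) free k))

  freeEnded : ℕ → Dual
  freeEnded = walks (λ _ → endsFree) 0 free

  walks-recurrence : ∀ φ n → let U = walks (λ _ → φ) 0 free in
    U (2 + n) ≡ y² ⊗ U (1 + n) ⊕ (y² ⊗ (y ⊗ conv freeEnded U n) ⊕ y ⊗ freeEnded (1 + n) ⊗ φ forced)
  walks-recurrence φ n = begin
    U (2 + n)
      ≡⟨ last-passage φ (2 + n) 0 free ⟩
    y² ⊗ U (1 + n) ⊕ conv (walks endsAtFloor 0 free) ν (2 + n)
      ≡⟨ cong (y² ⊗ U (1 + n) ⊕_) (conv-suc (1 + n) (walks endsAtFloor 0 free) ν) ⟩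
    y² ⊗ U (1 + n) ⊕ conv (λ j → walks endsAtFloor 0 free (suc j)) ν (1 + n)
      ≡⟨ cong (y² ⊗ U (1 + n) ⊕_) (conv-cong (1 + n) {g′ = ν} (λ j _ → walks-toFloor j 0 free) (λ _ _ → refl)) ⟩
    y² ⊗ U (1 + n) ⊕ (conv (λ j → y ⊗ freeEnded j) (λ j → y² ⊗ U j) n ⊕ y ⊗ freeEnded (1 + n) ⊗ φ forced)
      ≡⟨ cong (λ t → y² ⊗ U (1 + n) ⊕ (t ⊕ y ⊗ freeEnded (1 + n) ⊗ φ forced))
              (trans (conv-scaleʳ n y² (λ j → y ⊗ freeEnded j) U) (cong (y² ⊗_) (conv-scaleˡ n y freeEnded U))) ⟩
    y² ⊗ U (1 + n) ⊕ (y² ⊗ (y ⊗ conv freeEnded U n) ⊕ y ⊗ freeEnded (1 + n) ⊗ φ forced)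
      ∎
    where
    open ≡-Reasoning
    U = walks (λ _ → φ) 0 free
    ν = escape φ forced

  open ℕ-Series using ()
    renaming (conv to convℕ; conv-comm to convℕ-comm; conv-distribʳ to convℕ-distribʳ;
              conv-distribˡ to convℕ-distribˡ; conv-scaleʳ to convℕ-scaleʳ; conv-scaleˡ to convℕ-scaleˡ)

  conv-dual : ∀ n F G → conv F G n ≡ ( convℕ (proj₁ ∘ F) (proj₁ ∘ G) n
                                     , convℕ (proj₁ ∘ F) (proj₂ ∘ G) n + convℕ (proj₂ ∘ F) (proj₁ ∘ G) n )
  conv-dual zero    F G = refl
  conv-dual (suc n) F G =
    trans (cong (_⊕ F (suc n) ⊗ G 0) (conv-dual n F (G ∘ suc)))
          (cong (convℕ (proj₁ ∘ F) (proj₁ ∘ G) (suc n) ,_)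
                (ℕ-Series.+-middleFour (convℕ (proj₁ ∘ F) (proj₂ ∘ G ∘ suc) n)
                                       (convℕ (proj₂ ∘ F) (proj₁ ∘ G ∘ suc) n)
                                       (proj₁ (F (suc n)) * proj₂ (G 0))
                                       (proj₂ (F (suc n)) * proj₁ (G 0))))

  recurrence-by-components : ∀ v u C e c →
    proj₁ v ≡ proj₁ u + proj₁ C + proj₁ e * proj₁ c →
    proj₂ v ≡ proj₂ u + 2 * proj₁ u + proj₂ C + 3 * proj₁ C + proj₁ e * proj₂ c + (proj₁ e + proj₂ e) * proj₁ c →
    v ≡ y² ⊗ u ⊕ (y² ⊗ (y ⊗ C) ⊕ y ⊗ e ⊗ c)
  recurrence-by-components v (u₁ , u₂) (C₁ , C₂) (e₁ , e₂) (c₁ , c₂) v₁≡ v₂≡ =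
    cong₂ _,_ (trans v₁≡ (count u₁ C₁ e₁ c₁)) (trans v₂≡ (weight u₁ u₂ C₁ C₂ e₁ e₂ c₁ c₂))
    where
    count : ∀ u₁ C₁ e₁ c₁ → u₁ + C₁ + e₁ * c₁ ≡ 1 * u₁ + (1 * (1 * C₁) + 1 * e₁ * c₁)
    count = solve-∀
    weight : ∀ u₁ u₂ C₁ C₂ e₁ e₂ c₁ c₂ →
      u₂ + 2 * u₁ + C₂ + 3 * C₁ + e₁ * c₂ + (e₁ + e₂) * c₁ ≡
      1 * u₂ + 2 * u₁ + (1 * (1 * C₂ + 1 * C₁) + 2 * (1 * C₁) + (1 * e₁ * c₂ + (1 * e₂ + 1 * e₁) * c₁))
    weight = solve-∀

  freeEndedFormula allWalksFormula : ℕ → Dual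
  freeEndedFormula n = (motzkin n 0 , 2 * trinomial n 1 + 3 * trinomial n 2)
  allWalksFormula  n = (motzkin n 0 + motzkin n 1 , 3 * trinomial n 1 + 7 * trinomial n 2 + 5 * trinomial n 3)

  convℕ-motzkin₀-trinomial : ∀ n b → convℕ (λ j → motzkin j 0) (λ l → trinomial l b) n ≡ trinomial (suc n) (suc b)
  convℕ-motzkin₀-trinomial n b = begin
    convℕ (λ j → motzkin j 0) (λ l → trinomial l b) n ≡⟨ convℕ-comm n _ _ ⟩
    convℕ (λ l → trinomial l b) (λ j → motzkin j 0) n ≡⟨ conv-trinomial-motzkin n b 0 ⟩
    trinomial (suc n) (suc (b + 0))                  ≡⟨ cong (λ h → trinomial (suc n) (suc h)) (+-identityʳ b) ⟩
    trinomial (suc n) (suc b)                        ∎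
    where open ≡-Reasoning

  convℕ-ε-motzkin : ∀ n b → convℕ (proj₂ ∘ freeEndedFormula) (λ l → motzkin l b) n ≡
                            2 * trinomial (suc n) (2 + b) + 3 * trinomial (suc n) (3 + b)
  convℕ-ε-motzkin n b = begin
    convℕ (λ j → 2 * trinomial j 1 + 3 * trinomial j 2) (λ l → motzkin l b) n
      ≡⟨ convℕ-distribˡ n (λ j → 2 * trinomial j 1) (λ j → 3 * trinomial j 2) _ ⟩
    convℕ (λ j → 2 * trinomial j 1) (λ l → motzkin l b) n + convℕ (λ j → 3 * trinomial j 2) (λ l → motzkin l b) n
      ≡⟨ cong₂ _+_ (convℕ-scaleˡ n 2 (λ j → trinomial j 1) _) (convℕ-scaleˡ n 3 (λ j → trinomial j 2) _) ⟩
    2 * convℕ (λ j → trinomial j 1) (λ l → motzkin l b) n + 3 * convℕ (λ j → trinomial j 2) (λ l → motzkin l b) n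
      ≡⟨ cong₂ (λ p q → 2 * p + 3 * q) (conv-trinomial-motzkin n 1 b) (conv-trinomial-motzkin n 2 b) ⟩
    2 * trinomial (suc n) (2 + b) + 3 * trinomial (suc n) (3 + b)
      ∎
    where open ≡-Reasoning

  conv-freeEndedFormula² : ∀ n → conv freeEndedFormula freeEndedFormula n ≡
    (motzkin (suc n) 1 , (2 * trinomial (suc n) 2 + 3 * trinomial (suc n) 3) + (2 * trinomial (suc n) 2 + 3 * trinomial (suc n) 3))
  conv-freeEndedFormula² n = trans (conv-dual n freeEndedFormula freeEndedFormula) (cong₂ _,_
    (conv-motzkin-motzkin n 0 0)
    (cong₂ _+_ (trans (convℕ-comm n (proj₁ ∘ freeEndedFormula) _) (convℕ-ε-motzkin n 0)) (convℕ-ε-motzkin n 0)))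

  conv-freeEndedFormula-allWalksFormula : ∀ n → conv freeEndedFormula allWalksFormula n ≡
    ( motzkin (suc n) 1 + motzkin (suc n) 2
    , (3 * trinomial (suc n) 2 + 7 * trinomial (suc n) 3 + 5 * trinomial (suc n) 4)
      + ((2 * trinomial (suc n) 2 + 3 * trinomial (suc n) 3) + (2 * trinomial (suc n) 3 + 3 * trinomial (suc n) 4)) )
  conv-freeEndedFormula-allWalksFormula n = trans (conv-dual n freeEndedFormula allWalksFormula) (cong₂ _,_
    (trans (convℕ-distribʳ n M₀ M₀ M₁) (cong₂ _+_ (conv-motzkin-motzkin n 0 0) (conv-motzkin-motzkin n 0 1)))
    (cong₂ _+_ motzkin₀-ε (trans (convℕ-distribʳ n (proj₂ ∘ freeEndedFormula) M₀ M₁)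
                                 (cong₂ _+_ (convℕ-ε-motzkin n 0) (convℕ-ε-motzkin n 1)))))
    where
    open ≡-Reasoning
    N = trinomial
    M₀ M₁ : ℕ → ℕ
    M₀ l = motzkin l 0
    M₁ l = motzkin l 1
    motzkin₀-ε : convℕ M₀ (λ l → 3 * N l 1 + 7 * N l 2 + 5 * N l 3) n ≡
                 3 * N (suc n) 2 + 7 * N (suc n) 3 + 5 * N (suc n) 4
    motzkin₀-ε = begin
      convℕ M₀ (λ l → 3 * N l 1 + 7 * N l 2 + 5 * N l 3) n
        ≡⟨ trans (convℕ-distribʳ n M₀ (λ l → 3 * N l 1 + 7 * N l 2) (λ l → 5 * N l 3))
                 (cong (_+ convℕ M₀ (λ l → 5 * N l 3) n) (convℕ-distribʳ n M₀ (λ l → 3 * N l 1) (λ l → 7 * N l 2))) ⟩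
      convℕ M₀ (λ l → 3 * N l 1) n + convℕ M₀ (λ l → 7 * N l 2) n
        + convℕ M₀ (λ l → 5 * N l 3) n
        ≡⟨ cong₂ _+_ (cong₂ _+_ (term 3 1) (term 7 2)) (term 5 3) ⟩
      3 * N (suc n) 2 + 7 * N (suc n) 3 + 5 * N (suc n) 4
        ∎
      where
      term : ∀ c b → convℕ M₀ (λ l → c * N l b) n ≡ c * N (suc n) (suc b)
      term c b = trans (convℕ-scaleʳ n c M₀ (λ l → N l b)) (cong (c *_) (convℕ-motzkin₀-trinomial n b))

  freeEndedFormula-recurrence : ∀ n → let E = freeEndedFormula in
    E (2 + n) ≡ y² ⊗ E (1 + n) ⊕ (y² ⊗ (y ⊗ conv E E n) ⊕ y ⊗ E (1 + n) ⊗ endsFree forced)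
  freeEndedFormula-recurrence n rewrite conv-freeEndedFormula² n =
    recurrence-by-components (freeEndedFormula (2 + n)) (freeEndedFormula (1 + n)) _ (freeEndedFormula (1 + n)) 0ᴰ
      (count (motzkin (1 + n) 0) (motzkin (1 + n) 1))
      (weight (motzkin (1 + n) 0) (motzkin (1 + n) 1) (N 0) (N 1) (N 2) (N 3)
              (trinomial-reflection (1 + n) 0) (trinomial-reflection (1 + n) 1))
    where
    N = trinomial (1 + n)
    count : ∀ m₀ m₁ → m₀ + m₁ ≡ m₀ + m₁ + m₀ * 0
    count = solve-∀
    weight : ∀ m₀ m₁ t₀ t₁ t₂ t₃ → t₀ ≡ m₀ + t₂ → t₁ ≡ m₁ + t₃ →
      2 * (t₀ + t₁ + t₂) + 3 * (t₁ + t₂ + t₃) ≡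
      (2 * t₁ + 3 * t₂) + 2 * m₀ + ((2 * t₂ + 3 * t₃) + (2 * t₂ + 3 * t₃)) + 3 * m₁ + m₀ * 0 + (m₀ + (2 * t₁ + 3 * t₂)) * 0
    weight m₀ m₁ _ _ t₂ t₃ refl refl = solve (m₀ ∷ m₁ ∷ t₂ ∷ t₃ ∷ [])

  allWalksFormula-recurrence : ∀ n → let E = freeEndedFormula; U = allWalksFormula in
    U (2 + n) ≡ y² ⊗ U (1 + n) ⊕ (y² ⊗ (y ⊗ conv E U n) ⊕ y ⊗ E (1 + n) ⊗ 1ᴰ)
  allWalksFormula-recurrence n rewrite conv-freeEndedFormula-allWalksFormula n =
    recurrence-by-components (allWalksFormula (2 + n)) (allWalksFormula (1 + n)) _ (freeEndedFormula (1 + n)) 1ᴰ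
      (count (M 0) (M 1) (M 2))
      (weight (M 0) (M 1) (M 2) (N 0) (N 1) (N 2) (N 3) (N 4)
              (trinomial-reflection (1 + n) 0) (trinomial-reflection (1 + n) 1) (trinomial-reflection (1 + n) 2))
    where
    M = motzkin (1 + n)
    N = trinomial (1 + n)
    count : ∀ m₀ m₁ m₂ → m₀ + m₁ + (m₀ + m₁ + m₂) ≡ m₀ + m₁ + (m₁ + m₂) + m₀ * 1
    count = solve-∀
    weight : ∀ m₀ m₁ m₂ t₀ t₁ t₂ t₃ t₄ → t₀ ≡ m₀ + t₂ → t₁ ≡ m₁ + t₃ → t₂ ≡ m₂ + t₄ →
      3 * (t₀ + t₁ + t₂) + 7 * (t₁ + t₂ + t₃) + 5 * (t₂ + t₃ + t₄) ≡
      (3 * t₁ + 7 * t₂ + 5 * t₃) + 2 * (m₀ + m₁)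
        + ((3 * t₂ + 7 * t₃ + 5 * t₄) + ((2 * t₂ + 3 * t₃) + (2 * t₃ + 3 * t₄)))
        + 3 * (m₁ + m₂) + m₀ * 0 + (m₀ + (2 * t₁ + 3 * t₂)) * 1
    weight m₀ m₁ m₂ _ _ _ t₃ t₄ refl refl refl = solve (m₀ ∷ m₁ ∷ m₂ ∷ t₃ ∷ t₄ ∷ [])

  freeEnded≡formula : ∀ n → freeEnded n ≡ freeEndedFormula n
  freeEnded≡formula = <-rec _ step
    where
    step : ∀ n → (∀ {m} → m < n → freeEnded m ≡ freeEndedFormula m) → freeEnded n ≡ freeEndedFormula n
    step zero          _       = refl
    step (suc zero)    _       = refl
    step (suc (suc n)) earlier = begin
      freeEnded (2 + n)
        ≡⟨ walks-recurrence endsFree n ⟩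
      y² ⊗ freeEnded (1 + n) ⊕ (y² ⊗ (y ⊗ conv freeEnded freeEnded n) ⊕ y ⊗ freeEnded (1 + n) ⊗ 0ᴰ)
        ≡⟨ cong₂ (λ e c → y² ⊗ e ⊕ (y² ⊗ (y ⊗ c) ⊕ y ⊗ e ⊗ 0ᴰ)) (earlier ≤-refl) (conv-cong n agreeUpTo agreeUpTo) ⟩
      y² ⊗ E (1 + n) ⊕ (y² ⊗ (y ⊗ conv E E n) ⊕ y ⊗ E (1 + n) ⊗ 0ᴰ)
        ≡⟨ sym (freeEndedFormula-recurrence n) ⟩
      freeEndedFormula (2 + n)
        ∎
      where
      open ≡-Reasoning
      E = freeEndedFormula
      agreeUpTo : ∀ i → i ≤ n → freeEnded i ≡ E i
      agreeUpTo i i≤n = earlier (s≤s (m≤n⇒m≤1+n i≤n))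

  allWalks≡formula : ∀ n → allWalks n ≡ allWalksFormula n
  allWalks≡formula = <-rec _ step
    where
    step : ∀ n → (∀ {m} → m < n → allWalks m ≡ allWalksFormula m) → allWalks n ≡ allWalksFormula n
    step zero          _       = refl
    step (suc zero)    _       = refl
    step (suc (suc n)) earlier = begin
      allWalks (2 + n)
        ≡⟨ walks-recurrence (λ _ → 1ᴰ) n ⟩
      y² ⊗ allWalks (1 + n) ⊕ (y² ⊗ (y ⊗ conv freeEnded allWalks n) ⊕ y ⊗ freeEnded (1 + n) ⊗ 1ᴰ)
        ≡⟨ cong₂ (λ u t → y² ⊗ u ⊕ t) (earlier ≤-refl)
                 (cong₂ (λ c e → y² ⊗ (y ⊗ c) ⊕ y ⊗ e ⊗ 1ᴰ) (conv-cong n (λ i _ → freeEnded≡formula i) agreeUpTo)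
                                                          (freeEnded≡formula (1 + n))) ⟩
      y² ⊗ U (1 + n) ⊕ (y² ⊗ (y ⊗ conv freeEndedFormula U n) ⊕ y ⊗ freeEndedFormula (1 + n) ⊗ 1ᴰ)
        ≡⟨ sym (allWalksFormula-recurrence n) ⟩
      allWalksFormula (2 + n)
        ∎
      where
      open ≡-Reasoning
      U = allWalksFormula
      agreeUpTo : ∀ i → i ≤ n → allWalks i ≡ U i
      agreeUpTo i i≤n = earlier (s≤s (m≤n⇒m≤1+n i≤n))

  2s+5T+4T≡3T : ∀ k → 2 * s (suc k) + 5 * T (suc k) + 4 * T (2 + k) ≡ 3 * T (3 + k)
  2s+5T+4T≡3T k = begin
    2 * s (suc k) + 5 * T (suc k) + 4 * T (2 + k)
      ≡⟨ cong₂ (λ a b → a + 4 * b) (cong₂ (λ a b → 2 * a + 5 * b) s≡formula (T≡trinomial (suc k))) (T≡trinomial (2 + k)) ⟩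
    2 * proj₂ (y² ⊗ allWalksFormula k) + 5 * trinomial (suc k) 0 + 4 * trinomial (2 + k) 0
      ≡⟨ rows (motzkin k 0) (motzkin k 1) (N 0) (N 1) (N 2) (N 3) (trinomial-reflection k 0) (trinomial-reflection k 1) ⟩
    3 * trinomial (3 + k) 0
      ≡⟨ sym (cong (3 *_) (T≡trinomial (3 + k))) ⟩
    3 * T (3 + k)
      ∎
    where
    open ≡-Reasoning
    N = trinomial k

    s≡formula : s (suc k) ≡ proj₂ (y² ⊗ allWalksFormula k)
    s≡formula = trans (s≡proj₂[y²⊗allWalks] k) (cong (λ w → proj₂ (y² ⊗ w)) (allWalks≡formula k))

    rows : ∀ m₀ m₁ t₀ t₁ t₂ t₃ → t₀ ≡ m₀ + t₂ → t₁ ≡ m₁ + t₃ →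
      let t′₀ = t₁ + t₀ + t₁ ; t′₁ = t₀ + t₁ + t₂ ; t′₂ = t₁ + t₂ + t₃
      in 2 * (1 * (3 * t₁ + 7 * t₂ + 5 * t₃) + 2 * (m₀ + m₁)) + 5 * t′₀ + 4 * (t′₁ + t′₀ + t′₁)
         ≡ 3 * ((t′₀ + t′₁ + t′₂) + (t′₁ + t′₀ + t′₁) + (t′₀ + t′₁ + t′₂))
    rows m₀ m₁ _ _ t₂ t₃ refl refl = solve (m₀ ∷ m₁ ∷ t₂ ∷ t₃ ∷ [])

open SemiperimeterSum using (2s+5T+4T≡3T)

open import Data.Integer using (ℤ; +_; _+_; _*_; -_)
open import Data.Integer.Properties using (pos-+; pos-*)
import Data.Integer.Tactic.RingSolver as ℤ-Solver

isolate : ∀ {x b c d : ℤ} → x + b + c ≡ d → x ≡ - b + - c + d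
isolate {x} {b} {c} {d} x+b+c≡d = begin
  x                         ≡⟨ add-and-subtract x b c ⟩
  x + b + c + (- b + - c)   ≡⟨ cong (_+ (- b + - c)) x+b+c≡d ⟩
  d + (- b + - c)           ≡⟨ rotate d b c ⟩
  - b + - c + d             ∎
  where
  open ≡-Reasoning
  add-and-subtract : ∀ x b c → x ≡ x + b + c + (- b + - c)
  add-and-subtract = ℤ-Solver.solve-∀
  rotate : ∀ d b c → d + (- b + - c) ≡ - b + - c + d
  rotate = ℤ-Solver.solve-∀

ℕ-identity⇒ℤ : ∀ a b c d → 2 Nat.* a Nat.+ 5 Nat.* b Nat.+ 4 Nat.* c ≡ 3 Nat.* d →
               + 2 * + a ≡ - (+ 5 * + b) + - (+ 4 * + c) + + 3 * + d
ℕ-identity⇒ℤ a b c d eq = isolate (begin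
  + 2 * + a + + 5 * + b + + 4 * + c             ≡⟨ sym (cong₂ _+_ (cong₂ _+_ (pos-* 2 a) (pos-* 5 b)) (pos-* 4 c)) ⟩
  + (2 Nat.* a) + + (5 Nat.* b) + + (4 Nat.* c) ≡⟨ sym (cong (_+ + (4 Nat.* c)) (pos-+ (2 Nat.* a) (5 Nat.* b))) ⟩
  + (2 Nat.* a Nat.+ 5 Nat.* b) + + (4 Nat.* c) ≡⟨ sym (pos-+ (2 Nat.* a Nat.+ 5 Nat.* b) (4 Nat.* c)) ⟩
  + (2 Nat.* a Nat.+ 5 Nat.* b Nat.+ 4 Nat.* c) ≡⟨ cong +_ eq ⟩
  + (3 Nat.* d)                                 ≡⟨ pos-* 3 d ⟩
  + 3 * + d                                     ∎)
  where open ≡-Reasoning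

corollary3p5 : (n : ℕ) → n ≥ 1 →
    + 2 * + s n ≡ - (+ 5 * + T n) + - (+ 4 * + T (ℕ.suc n)) + + 3 * + T (ℕ.suc (ℕ.suc n))
corollary3p5 (suc k) _ = ℕ-identity⇒ℤ (s (suc k)) (T (suc k)) (T (2 Nat.+ k)) (T (3 Nat.+ k)) (2s+5T+4T≡3T k)
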